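{- Let $n\ge1$ be an essential number and let $\mathcal{V}(Z(n))=B_1\times\dots\times B_s$. Then \[n\le f_{2d(B_1)+\dots+2d(B_s)+s+1}-2,\] with equality if and only if $s=1$ and $B_1=(2,\dots,2)$; in that case $n=f_{2\dim(B_1)+2}-2$, where $\dim(B_1)$ is the number of coordinates of $B_1$.
   Context: $f_0=f_1=1$, $f_i=f_{i-1}+f_{i-2}$ ($i\ge2$). A 2-partition is a finite set of positive integers with consecutive differences $\ge2$; $Z(n)$ is the unique 2-partition $\{\mu_1<\dots<\mu_q\}$ with $n=\sum f_{\mu_a}$. The canonical form of a nonempty 2-partition is its decomposition into maximal runs $I_1,\dots,I_s$ of consecutive elements of equal parity. The associated vector of $\{i_1<\dots<i_q\}$ is $(\alpha_1,\dots,\alpha_q)$, $\alpha_1=\lfloor(i_1-1)/2\rfloor+1$, $\alpha_r=\lfloor(i_r-i_{r-1})/2\rfloor+1$; cutting it into consecutive blocks of lengths $|I_1|,\dots,|I_s|$ gives $\mathcal{V}(I)=B_1\times\cdots\times B_s$. For a vector $B=(\beta_1,\dots,\beta_q)$, $d(B)=\beta_1+\dots+\beta_q-q$. Define integers $D(\emptyset)=1$, $D(\alpha_1)=\alpha_1$, $D(\alpha_1,\dots,\alpha_r)=\alpha_rD(\alpha_1,\dots,\alpha_{r-1})-D(\alpha_1,\dots,\alpha_{r-2})$, and $\langle B\rangle=D(\beta_2,\dots,\beta_q)/D(\beta_1,\dots,\beta_q)$. Let $\Gamma$ be the free monoid generated by the nonzero elements of $\mathbb{Q}/\mathbb{Z}$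 (identified with fractions in $(0,1)$). Define $\pi:\mathbb{N}\to\Gamma$ by $\pi(0)=$ unit and, for $n\ge1$ with $\mathcal{V}(Z(n))=B_1\times\cdots\times B_s$, $\pi(n)=\overline{\langle B_1\rangle}*\langle B_2\rangle*\cdots*\langle B_s\rangle$, where $\overline{\langle B_1\rangle}$ is the class of $\langle B_1\rangle$ in $\mathbb{Q}/\mathbb{Z}$ (omitted if $0$). A number $n$ is essential if $n$ is the smallest element of $\pi^{ -1}(\pi(n))$. -}

module Defs where

open import Data.Nat as ℕ using (ℕ; zero; suc; _+_; _*_; _∸_; _≤_; _<_; _≤ᵇ_; _/_)
open import Data.Nat.Base using (_%_)
open import Data.Bool using (Bool; true; false; if_then_else_)
open import Data.Nat.ListAction using (sum)
open import Data.List using (List; []; _∷_; _++_; map; length; reverse; foldl; [_])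
open import Data.Product using (_×_; _,_; proj₁; proj₂)
open import Data.Integer as ℤ using (ℤ; +_; +[1+_]; -[1+_])
open import Data.Rational as ℚ using (ℚ; 0ℚ)
open import Relation.Binary.PropositionalEquality using (_≡_; _≢_)
open import Relation.Nullary.Decidable using (⌊_⌋)

fib : ℕ → ℕ
fib zero = 1
fib (suc zero) = 1
fib (suc (suc n)) = fib (suc n) + fib n

largestIdx : ℕ → ℕ → ℕ → ℕ
largestIdx zero k n = k
largestIdx (suc fuel) k n = if fib (suc k) ≤ᵇ n then largestIdx fuel (suc k) n else k

zeckDesc : ℕ → ℕ → List ℕ
zeckDesc zero n = []
zeckDesc (suc fuel) zero = []
zeckDesc (suc fuel) (suc m) =
  let k = largestIdx (suc m) 1 (suc m) in k ∷ zeckDesc fuel (suc m ∸ fib k)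

-- Z(n): the Zeckendorf 2-partition of n, as an increasing list of indices ≥ 1
Z : ℕ → List ℕ
Z n = reverse (zeckDesc n n)

assocVecFrom : ℕ → List ℕ → List ℕ
assocVecFrom prev [] = []
assocVecFrom prev (i ∷ is) = ((i ∸ prev) / 2 + 1) ∷ assocVecFrom i is

assocVec : List ℕ → List ℕ
assocVec [] = []
assocVec (i ∷ is) = ((i ∸ 1) / 2 + 1) ∷ assocVecFrom i is

-- splitting a list of (index , coordinate) pairs into maximal runs of
-- consecutive elements whose indices have equal parity (canonical form)
sameParity : ℕ → ℕ → Bool
sameParity a b = ⌊ a % 2 ℕ.≟ b % 2 ⌋

insertRun : ℕ × ℕ → List (List (ℕ × ℕ)) → List (List (ℕ × ℕ))
insertRun x [] = [ [ x ] ]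
insertRun x ([] ∷ rs) = [ x ] ∷ rs
insertRun x ((y ∷ r) ∷ rs) =
  if sameParity (proj₁ x) (proj₁ y) then (x ∷ y ∷ r) ∷ rs else [ x ] ∷ (y ∷ r) ∷ rs

runs : List (ℕ × ℕ) → List (List (ℕ × ℕ))
runs [] = []
runs (x ∷ xs) = insertRun x (runs xs)

zipL : List ℕ → List ℕ → List (ℕ × ℕ)
zipL [] _ = []
zipL (_ ∷ _) [] = []
zipL (a ∷ as) (b ∷ bs) = (a , b) ∷ zipL as bs

-- 𝒱(I) = B₁ × ⋯ × B_s, as the list of blocks [B₁, …, B_s]
𝒱 : List ℕ → List (List ℕ)
𝒱 I = map (map proj₂) (runs (zipL I (assocVec I)))

d : List ℕ → ℕ
d B = sum B ∸ length B

-- D(α₁,…,α_r) via D(∅)=1, D(α₁)=α₁, D(…,α_r)=α_r D(…,α_{r-1}) − D(…,α_{r-2})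
Dstep : ℤ × ℤ → ℕ → ℤ × ℤ
Dstep (p , c) a = (c , ((+ a) ℤ.* c) ℤ.- p)

D : List ℕ → ℤ
D xs = proj₂ (foldl Dstep (+ 0 , + 1) xs)

-- a / b as a rational (b is always positive in our uses; 0 if b ≤ 0)
ratio : ℤ → ℤ → ℚ
ratio a +[1+ k ] = a ℚ./ suc k
ratio a _ = 0ℚ

⟨_⟩ : List ℕ → ℚ
⟨ [] ⟩ = 0ℚ
⟨ β ∷ βs ⟩ = ratio (D βs) (D (β ∷ βs))

-- the class in ℚ/ℤ, represented by its fractional representative in [0,1)
classQZ : ℚ → ℚ
classQZ p = p ℚ.- (ℚ.floor p ℚ./ 1)

-- Γ: free monoid on nonzero elements of ℚ/ℤ, represented as words (lists)
Γ : Set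
Γ = List ℚ

classWord : ℚ → Γ
classWord p = if ⌊ classQZ p ℚ.≟ 0ℚ ⌋ then [] else [ classQZ p ]

πBlocks : List (List ℕ) → Γ
πBlocks [] = []
πBlocks (B₁ ∷ Bs) = classWord ⟨ B₁ ⟩ ++ map ⟨_⟩ Bs

π : ℕ → Γ
π n = πBlocks (𝒱 (Z n))

Essential : ℕ → Set
Essential n = ∀ m → m < n → π m ≢ π n

-- Write Z(n) = {i₁ < ⋯ < i_q} and L = i_q; always n < f_{L+1}.
-- (i) An essential n has i₁ odd: otherwise lowering every part by one gives a smaller
-- number with the same canonical form.
-- (ii) For odd i₁ the exponent 2d(B₁) + ⋯ + 2d(B_s) + s equals L: a gap g between
-- consecutive parts contributes 2⌊g/2⌋ to the d's and, as it is a parity change exactly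
-- when g is odd, g mod 2 to s; the first part contributes i₁ = 2⌊(i₁ − 1)/2⌋ + 1.
-- (iii) With largest part L, the values f_{L+1} − 1 and f_{L+1} − 2 are only attained by
-- {1,3,…,L}, {2,4,…,L}, {3,5,…,L} and {1,4,6,…,L}. The first has the π of 0, the second
-- an even head, the last the π of the smaller {3,5,…,L−1}; the third has 𝒱 = (2,…,2).
module Submission where

open import Defs
open import Data.Bool using (true; false; T)
open import Data.Empty using (⊥-elim)
import Data.Integer as ℤ
import Data.Integer.Properties as ℤ
open import Data.Integer.DivMod using (div-pos-is-/ℕ)
open import Data.List
  using (List; []; _∷_; _++_; [_]; map; length; concat; reverse; reverseAcc; replicate; foldl)
open import Data.List.Properties
  using (reverse-involutive; concat-map; length-replicate; map-∘; ++-identityʳ; ∷-injectiveˡ; ∷-injectiveʳ)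
open import Data.List.Relation.Binary.Permutation.Propositional.Properties using (↭-reverse; map⁺)
open import Data.List.Relation.Unary.All using (All; []; _∷_)
open import Data.Nat
  using (ℕ; zero; suc; _+_; _*_; _∸_; _/_; _%_; _≤_; _<_; _≤′_; ≤′-refl; ≤′-step; z≤n; s≤s; _≤ᵇ_; >-nonZero)
open import Data.Nat.Coprimality as Coprime using (Coprime; 1-coprimeTo; coprime-+)
open import Data.Nat.DivMod using (m*n/n≡m; +-distrib-/; m*n%n≡0; m≡m%n+[m/n]*n; n/1≡n; m<n⇒m/n≡0)
open import Data.Nat.ListAction using (sum)
open import Data.Nat.ListAction.Properties using (sum-↭)
open import Data.Nat.Properties
open import Data.Nat.Tactic.RingSolver using (solve-∀)
open import Data.Product using (Σ; ∃-syntax; _×_; _,_; proj₁; proj₂; map₁)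
open import Data.Rational as ℚ using (ℚ; mkℚ; 0ℚ)
import Data.Rational.Properties as ℚ
open import Data.Sum using (_⊎_; inj₁; inj₂)
open import Data.Unit using (tt)
open import Function using (_∘_)
open import Relation.Binary.PropositionalEquality hiding ([_])
open import Relation.Nullary using (yes; no)

-- Fibonacci numbers

1≤fib : ∀ n → 1 ≤ fib n
1≤fib zero = s≤s z≤n
1≤fib (suc zero) = s≤s z≤n
1≤fib (suc (suc n)) = ≤-trans (1≤fib (suc n)) (m≤m+n _ _)

fib-≤-suc : ∀ n → fib n ≤ fib (suc n)
fib-≤-suc zero = ≤-refl
fib-≤-suc (suc n) = m≤m+n _ _

fib-mono-≤′ : ∀ {m n} → m ≤′ n → fib m ≤ fib n
fib-mono-≤′ ≤′-refl = ≤-refl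
fib-mono-≤′ (≤′-step {n} m≤′n) = ≤-trans (fib-mono-≤′ m≤′n) (fib-≤-suc n)

fib-mono-≤ : ∀ {m n} → m ≤ n → fib m ≤ fib n
fib-mono-≤ = fib-mono-≤′ ∘ ≤⇒≤′

n<fib[1+n] : ∀ n → n < fib (suc n)
n<fib[1+n] zero = s≤s z≤n
n<fib[1+n] (suc n) =
  subst (_≤ fib (suc (suc n))) (+-comm (suc n) 1) (+-mono-≤ (n<fib[1+n] n) (1≤fib n))

n≤fib : ∀ n → n ≤ fib n
n≤fib zero = z≤n
n≤fib (suc n) = n<fib[1+n] n

fib[1+k]≡fib[k]+fib[1+k∸2] : ∀ k → 1 ≤ k → fib (suc k) ≡ fib k + fib (suc (k ∸ 2))
fib[1+k]≡fib[k]+fib[1+k∸2] (suc zero) _ = refl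
fib[1+k]≡fib[k]+fib[1+k∸2] (suc (suc k)) _ = refl

-- Zeckendorf representations

fibSum : List ℕ → ℕ
fibSum I = sum (map fib I)

fibSum-reverse : ∀ J → fibSum (reverse J) ≡ fibSum J
fibSum-reverse J = sum-↭ (map⁺ fib (↭-reverse J))

-- 2-partitions listed increasingly with parts ≥ lo, resp. decreasingly with parts in [1, t],
-- the order in which the greedy algorithm zeckDesc produces them.
data TwoPartition↑ : ℕ → List ℕ → Set where
  nil  : ∀ {lo} → TwoPartition↑ lo []
  cons : ∀ {lo i I} → lo ≤ i → TwoPartition↑ (i + 2) I → TwoPartition↑ lo (i ∷ I)

data TwoPartition↓ : ℕ → List ℕ → Set where
  nil  : ∀ {t} → TwoPartition↓ t []
  cons : ∀ {t k J} → 1 ≤ k → k ≤ t → TwoPartition↓ (k ∸ 2) J → TwoPartition↓ t (k ∷ J)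

TwoPartition↑-weaken : ∀ {lo lo′ I} → lo′ ≤ lo → TwoPartition↑ lo I → TwoPartition↑ lo′ I
TwoPartition↑-weaken _ nil = nil
TwoPartition↑-weaken lo′≤lo (cons lo≤i pI) = cons (≤-trans lo′≤lo lo≤i) pI

TwoPartition↓-weaken : ∀ {t t′ J} → t ≤ t′ → TwoPartition↓ t J → TwoPartition↓ t′ J
TwoPartition↓-weaken _ nil = nil
TwoPartition↓-weaken t≤t′ (cons 1≤k k≤t pJ) = cons 1≤k (≤-trans k≤t t≤t′) pJ

TwoPartition↓-zero : ∀ {J} → TwoPartition↓ 0 J → J ≡ []
TwoPartition↓-zero nil = refl
TwoPartition↓-zero (cons (s≤s _) () _)

fibSum<fib : ∀ {t J} → TwoPartition↓ t J → fibSum J < fib (suc t)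
fibSum<fib {t} nil = 1≤fib (suc t)
fibSum<fib {t} (cons {k = k} {J} 1≤k k≤t pJ) = begin-strict
  fib k + fibSum J           <⟨ +-monoʳ-< (fib k) (fibSum<fib pJ) ⟩
  fib k + fib (suc (k ∸ 2))  ≡⟨ fib[1+k]≡fib[k]+fib[1+k∸2] k 1≤k ⟨
  fib (suc k)                ≤⟨ fib-mono-≤ (s≤s k≤t) ⟩
  fib (suc t)                ∎
  where open ≤-Reasoning

Representable : ℕ → Set
Representable t = ∀ n → n < fib (suc t) → ∃[ J ] TwoPartition↓ t J × fibSum J ≡ n

-- Greedy step: either n < f_{t+2}, or the remainder n − f_{t+2} is below f_{t+1}.
representable-step : ∀ t → Representable (suc t) → Representable t → Representable (suc (suc t))
representable-step t rep₁ rep₀ n n<F with n <? fib (suc (suc t))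
... | yes n<F′ =
  let J , pJ , sumJ = rep₁ n n<F′
  in J , TwoPartition↓-weaken (n≤1+n _) pJ , sumJ
... | no n≮F′ =
  let J , pJ , sumJ = rep₀ (n ∸ fib (suc (suc t))) rest<
  in suc (suc t) ∷ J , cons (s≤s z≤n) ≤-refl pJ ,
     trans (cong (fib (suc (suc t)) +_) sumJ) (m+[n∸m]≡n (≮⇒≥ n≮F′))
  where
  rest< : n ∸ fib (suc (suc t)) < fib (suc t)
  rest< = m<n+o⇒m∸n<o n (fib (suc (suc t))) ⦃ >-nonZero (1≤fib (suc t)) ⦄ n<F

representable : ∀ t → Representable t
representable zero zero _ = [] , nil , refl
representable zero (suc n) (s≤s ())
representable (suc zero) zero _ = [] , nil , refl
representable (suc zero) (suc zero) _ = 1 ∷ [] , cons ≤-refl ≤-refl nil , refl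
representable (suc zero) (suc (suc n)) (s≤s (s≤s ()))
representable (suc (suc t)) = representable-step t (representable (suc t)) (representable t)

largestIdx-spec : ∀ fuel j k m → j ≤ k → k ≤ fuel + j → fib k ≤ m → m < fib (suc k) →
                  largestIdx fuel j m ≡ k
largestIdx-spec zero j k m j≤k k≤j _ _ = ≤-antisym j≤k k≤j
largestIdx-spec (suc fuel) j k m j≤k k≤ fk≤m m<fk′
  with fib (suc j) ≤ᵇ m in eq | m≤n⇒m<n∨m≡n j≤k
... | true  | inj₁ j<k =
  largestIdx-spec fuel (suc j) k m j<k (subst (k ≤_) (sym (+-suc fuel j)) k≤) fk≤m m<fk′
... | true  | inj₂ refl = ⊥-elim (<⇒≱ m<fk′ (≤ᵇ⇒≤ _ _ (subst T (sym eq) tt)))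
... | false | inj₁ j<k = ⊥-elim (subst T eq (≤⇒≤ᵇ (≤-trans (fib-mono-≤ j<k) fk≤m)))
... | false | inj₂ j≡k = j≡k

zeckDesc-unique : ∀ fuel n {t J} → TwoPartition↓ t J → fibSum J ≡ n → n ≤ fuel → zeckDesc fuel n ≡ J
zeckDesc-unique zero _ nil _ _ = refl
zeckDesc-unique (suc fuel) _ nil refl _ = refl
zeckDesc-unique _ zero (cons {k = k} {J} _ _ _) sum≡0 _ =
  ⊥-elim (<⇒≢ (≤-trans (1≤fib k) (m≤m+n (fib k) (fibSum J))) (sym sum≡0))
zeckDesc-unique zero (suc m) (cons _ _ _) _ ()
zeckDesc-unique (suc fuel) (suc m) (cons {k = k} {J} 1≤k _ pJ) sum≡ (s≤s m≤fuel) =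
  begin
    zeckDesc (suc fuel) (suc m)        ≡⟨ cong (λ x → x ∷ zeckDesc fuel (suc m ∸ fib x)) top≡k ⟩
    k ∷ zeckDesc fuel (suc m ∸ fib k)  ≡⟨ cong (k ∷_) rest ⟩
    k ∷ J                              ∎
  where
  open ≡-Reasoning
  fk≤ : fib k ≤ suc m
  fk≤ = subst (fib k ≤_) sum≡ (m≤m+n (fib k) (fibSum J))
  top≡k : largestIdx (suc m) 1 (suc m) ≡ k
  top≡k = largestIdx-spec (suc m) 1 k (suc m) 1≤k
            (≤-trans (≤-trans (n≤fib k) fk≤) (m≤m+n (suc m) 1)) fk≤
            (subst (_< fib (suc k)) sum≡ (fibSum<fib (cons 1≤k ≤-refl pJ)))
  rest≡ : suc m ∸ fib k ≡ fibSum J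
  rest≡ = trans (cong (_∸ fib k) (sym sum≡)) (m+n∸m≡n (fib k) (fibSum J))
  rest : zeckDesc fuel (suc m ∸ fib k) ≡ J
  rest = zeckDesc-unique fuel (suc m ∸ fib k) pJ (sym rest≡)
           (≤-trans (∸-monoʳ-≤ (suc m) (1≤fib k)) m≤fuel)

reverse↓ : ∀ {t J acc} → TwoPartition↓ t J → TwoPartition↑ (t + 2) acc →
           TwoPartition↑ 1 (reverseAcc acc J)
reverse↓ {t} nil pacc = TwoPartition↑-weaken (≤-trans (s≤s z≤n) (m≤n+m 2 t)) pacc
reverse↓ {J = suc zero ∷ J} (cons 1≤k k≤t pJ) pacc with TwoPartition↓-zero pJ
... | refl = cons ≤-refl (TwoPartition↑-weaken (+-monoˡ-≤ 2 k≤t) pacc)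
reverse↓ {J = suc (suc k) ∷ J} (cons 1≤k k≤t pJ) pacc =
  reverse↓ pJ (cons (≤-reflexive (+-comm k 2)) (TwoPartition↑-weaken (+-monoˡ-≤ 2 k≤t) pacc))

reverse↑ : ∀ {lo t I acc} → TwoPartition↑ lo I → TwoPartition↓ t acc → t + 2 ≤ lo →
           ∃[ T ] TwoPartition↓ T (reverseAcc acc I)
reverse↑ {t = t} nil pacc _ = t , pacc
reverse↑ {t = t} (cons {i = i} lo≤i pI) pacc t+2≤lo =
  reverse↑ pI (cons 1≤i ≤-refl (TwoPartition↓-weaken t≤i∸2 pacc)) ≤-refl
  where
  1≤i : 1 ≤ i
  1≤i = ≤-trans (≤-trans (≤-trans (s≤s z≤n) (m≤n+m 2 t)) t+2≤lo) lo≤i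
  t≤i∸2 : t ≤ i ∸ 2
  t≤i∸2 = subst (_≤ i ∸ 2) (m+n∸n≡m t 2) (∸-monoˡ-≤ 2 (≤-trans t+2≤lo lo≤i))

Z-fibSum : ∀ {I} → TwoPartition↑ 1 I → Z (fibSum I) ≡ I
Z-fibSum nil = refl
Z-fibSum {I} (cons 1≤i pI) =
  let _ , pJ = reverse↑ pI (cons 1≤i ≤-refl nil) ≤-refl
  in trans (cong reverse (zeckDesc-unique (fibSum I) (fibSum I) pJ (fibSum-reverse I) ≤-refl))
           (reverse-involutive I)

Z-unique : ∀ {n I} → TwoPartition↑ 1 I → fibSum I ≡ n → Z n ≡ I
Z-unique pI refl = Z-fibSum pI

Z-spec : ∀ n → TwoPartition↑ 1 (Z n) × fibSum (Z n) ≡ n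
Z-spec n =
  let J , pJ , sumJ = representable n n (n<fib[1+n] n)
      Z≡ : Z n ≡ reverse J
      Z≡ = cong reverse (zeckDesc-unique n n pJ sumJ ≤-refl)
  in subst (TwoPartition↑ 1) (sym Z≡) (reverse↓ pJ nil) ,
     trans (cong fibSum Z≡) (trans (fibSum-reverse J) sumJ)

-- The canonical form and its weight

sameParity-suc : ∀ a b → sameParity (suc a) (suc b) ≡ sameParity a b
sameParity-suc zero zero = refl
sameParity-suc zero (suc zero) = refl
sameParity-suc zero (suc (suc b)) = sameParity-suc zero b
sameParity-suc (suc zero) zero = refl
sameParity-suc (suc zero) (suc zero) = refl
sameParity-suc (suc zero) (suc (suc b)) = sameParity-suc 1 b
sameParity-suc (suc (suc a)) b = sameParity-suc a b

sameParity-refl : ∀ a → sameParity a a ≡ true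
sameParity-refl zero = refl
sameParity-refl (suc zero) = refl
sameParity-refl (suc (suc a)) = sameParity-refl a

SameParityByGap : ℕ → ℕ → Set
SameParityByGap p j =
  (sameParity p j ≡ true × (j ∸ p) % 2 ≡ 0) ⊎ (sameParity p j ≡ false × (j ∸ p) % 2 ≡ 1)

sameParity-zero : ∀ j → SameParityByGap 0 j
sameParity-zero zero = inj₁ (refl , refl)
sameParity-zero (suc zero) = inj₂ (refl , refl)
sameParity-zero (suc (suc j)) = sameParity-zero j

sameParity-gap : ∀ {p j} → p ≤ j → SameParityByGap p j
sameParity-gap {zero} {j} _ = sameParity-zero j
sameParity-gap {suc p} {suc j} (s≤s p≤j) rewrite sameParity-suc p j = sameParity-gap p≤j

blocks : List (List (ℕ × ℕ)) → List (List ℕ)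
blocks = map (map proj₂)

shift : ℕ × ℕ → ℕ × ℕ
shift = map₁ suc

insertRun-shift : ∀ x R →
  insertRun (shift x) (map (map shift) R) ≡ map (map shift) (insertRun x R)
insertRun-shift x [] = refl
insertRun-shift x ([] ∷ rs) = refl
insertRun-shift (i , a) (((j , b) ∷ r) ∷ rs) rewrite sameParity-suc i j with sameParity i j
... | true = refl
... | false = refl

runs-shift : ∀ P → runs (map shift P) ≡ map (map shift) (runs P)
runs-shift [] = refl
runs-shift (x ∷ P) = trans (cong (insertRun (shift x)) (runs-shift P)) (insertRun-shift x (runs P))

blocks-shift : ∀ R → blocks (map (map shift) R) ≡ blocks R
blocks-shift [] = refl
blocks-shift (r ∷ R) = cong₂ _∷_ (sym (map-∘ r)) (blocks-shift R)

zipL-shift : ∀ xs ys → zipL (map suc xs) ys ≡ map shift (zipL xs ys)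
zipL-shift [] ys = refl
zipL-shift (x ∷ xs) [] = refl
zipL-shift (x ∷ xs) (y ∷ ys) = cong ((suc x , y) ∷_) (zipL-shift xs ys)

assocVecFrom-shift : ∀ p xs → assocVecFrom (suc p) (map suc xs) ≡ assocVecFrom p xs
assocVecFrom-shift p [] = refl
assocVecFrom-shift p (x ∷ xs) = cong (((x ∸ p) / 2 + 1) ∷_) (assocVecFrom-shift x xs)

[1+c*2]/2≡c : ∀ c → suc (c * 2) / 2 ≡ c
[1+c*2]/2≡c c = trans (+-distrib-/ 1 (c * 2) 1%2+c*2%2<2) (m*n/n≡m c 2)
  where
  1%2+c*2%2<2 : 1 % 2 + (c * 2) % 2 < 2
  1%2+c*2%2<2 = subst (λ r → 1 % 2 + r < 2) (sym (m*n%n≡0 c 2)) ≤-refl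

assocVec-shift : ∀ c is → assocVec (map suc (suc (c * 2) ∷ is)) ≡ assocVec (suc (c * 2) ∷ is)
assocVec-shift c is =
  cong₂ _∷_ (cong (_+ 1) (trans ([1+c*2]/2≡c c) (sym (m*n/n≡m c 2))))
            (assocVecFrom-shift (suc (c * 2)) is)

-- Gaps and parity changes are shift-invariant, and ⌊(i − 1)/2⌋ = ⌊i/2⌋ for odd i.
𝒱-shift : ∀ c is → 𝒱 (map suc (suc (c * 2) ∷ is)) ≡ 𝒱 (suc (c * 2) ∷ is)
𝒱-shift c is = begin
  blocks (runs (zipL (map suc I) (assocVec (map suc I))))
    ≡⟨ cong (λ v → blocks (runs (zipL (map suc I) v))) (assocVec-shift c is) ⟩
  blocks (runs (zipL (map suc I) (assocVec I)))  ≡⟨ cong (blocks ∘ runs) (zipL-shift I (assocVec I)) ⟩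
  blocks (runs (map shift P))                    ≡⟨ cong blocks (runs-shift P) ⟩
  blocks (map (map shift) (runs P))              ≡⟨ blocks-shift (runs P) ⟩
  blocks (runs P)                                ∎
  where
  open ≡-Reasoning
  I = suc (c * 2) ∷ is
  P = zipL I (assocVec I)

concat-insertRun : ∀ x R → concat (insertRun x R) ≡ x ∷ concat R
concat-insertRun x [] = refl
concat-insertRun x ([] ∷ rs) = refl
concat-insertRun (i , _) (((j , _) ∷ r) ∷ rs) with sameParity i j
... | true = refl
... | false = refl

concat-runs : ∀ P → concat (runs P) ≡ P
concat-runs [] = refl
concat-runs (x ∷ P) = trans (concat-insertRun x (runs P)) (cong (x ∷_) (concat-runs P))

map-proj₂-zipL : ∀ xs ys → length xs ≡ length ys → map proj₂ (zipL xs ys) ≡ ys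
map-proj₂-zipL [] [] _ = refl
map-proj₂-zipL (x ∷ xs) (y ∷ ys) eq = cong (y ∷_) (map-proj₂-zipL xs ys (suc-injective eq))

length-assocVecFrom : ∀ p xs → length (assocVecFrom p xs) ≡ length xs
length-assocVecFrom p [] = refl
length-assocVecFrom p (x ∷ xs) = cong suc (length-assocVecFrom x xs)

length-assocVec : ∀ I → length (assocVec I) ≡ length I
length-assocVec [] = refl
length-assocVec (i ∷ is) = cong suc (length-assocVecFrom i is)

concat-𝒱 : ∀ I → concat (𝒱 I) ≡ assocVec I
concat-𝒱 I = begin
  concat (blocks (runs P))     ≡⟨ concat-map (runs P) ⟩
  map proj₂ (concat (runs P))  ≡⟨ cong (map proj₂) (concat-runs P) ⟩
  map proj₂ P                  ≡⟨ map-proj₂-zipL I (assocVec I) (sym (length-assocVec I)) ⟩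
  assocVec I                   ∎
  where
  open ≡-Reasoning
  P = zipL I (assocVec I)

weight : List (List ℕ) → ℕ
weight Bs = 2 * sum (map d Bs) + length Bs

d-cons : ∀ h B → length B ≤ sum B → d ((h + 1) ∷ B) ≡ h + d B
d-cons h B len≤sum = begin
  (h + 1 + sum B) ∸ suc (length B)  ≡⟨ cong (λ x → x + sum B ∸ suc (length B)) (+-comm h 1) ⟩
  (h + sum B) ∸ length B            ≡⟨ +-∸-assoc h len≤sum ⟩
  h + d B                           ∎
  where open ≡-Reasoning

weight-join : ∀ h B Bs → length B ≤ sum B → weight (((h + 1) ∷ B) ∷ Bs) ≡ 2 * h + weight (B ∷ Bs)
weight-join h B Bs len≤sum = begin
  2 * (d ((h + 1) ∷ B) + S) + suc l  ≡⟨ cong (λ x → 2 * (x + S) + suc l) (d-cons h B len≤sum) ⟩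
  2 * (h + d B + S) + suc l          ≡⟨ distribute h (d B) S l ⟩
  2 * h + (2 * (d B + S) + suc l)    ∎
  where
  open ≡-Reasoning
  S = sum (map d Bs)
  l = length Bs
  distribute : ∀ h x S l → 2 * (h + x + S) + suc l ≡ 2 * h + (2 * (x + S) + suc l)
  distribute = solve-∀

weight-split : ∀ h Bs → weight ([ h + 1 ] ∷ Bs) ≡ 2 * h + 1 + weight Bs
weight-split h Bs = begin
  2 * (d [ h + 1 ] + S) + suc l  ≡⟨ cong (λ x → 2 * (x + S) + suc l) d[h+1]≡h ⟩
  2 * (h + S) + suc l            ≡⟨ distribute h S l ⟩
  2 * h + 1 + (2 * S + l)        ∎
  where
  open ≡-Reasoning
  S = sum (map d Bs)
  l = length Bs
  d[h+1]≡h : d [ h + 1 ] ≡ h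
  d[h+1]≡h = trans (cong (_∸ 1) (+-identityʳ (h + 1))) (m+n∸n≡m h 1)
  distribute : ∀ h S l → 2 * (h + S) + suc l ≡ 2 * h + 1 + (2 * S + l)
  distribute = solve-∀

-- 𝒱 (i ∷ is) unfolds to blocks (canonicalRuns i ((i ∸ 1) / 2) is).
canonicalRuns : ℕ → ℕ → List ℕ → List (List (ℕ × ℕ))
canonicalRuns p h is = runs ((p , h + 1) ∷ zipL is (assocVecFrom p is))

canonicalRuns-head : ∀ p h is → Σ (List (ℕ × ℕ)) λ r → Σ (List (List (ℕ × ℕ))) λ rs →
  canonicalRuns p h is ≡ ((p , h + 1) ∷ r) ∷ rs × length (map proj₂ r) ≤ sum (map proj₂ r)
canonicalRuns-head p h [] = [] , [] , refl , z≤n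
canonicalRuns-head p h (j ∷ js) with canonicalRuns-head j ((j ∸ p) / 2) js
... | r , rs , eq , len≤sum rewrite eq with sameParity p j
...   | true  = (j , (j ∸ p) / 2 + 1) ∷ r , rs , refl , +-mono-≤ (m≤n+m 1 _) len≤sum
...   | false = [] , ((j , (j ∸ p) / 2 + 1) ∷ r) ∷ rs , refl , z≤n

-- A gap g = j − p contributes 2⌊g/2⌋ to d and, when odd, one more block.
weight-canonicalRuns-step : ∀ p h j js → p ≤ j →
  weight (blocks (canonicalRuns p h (j ∷ js)))
    ≡ 2 * h + (j ∸ p) % 2 + weight (blocks (canonicalRuns j ((j ∸ p) / 2) js))
weight-canonicalRuns-step p h j js p≤j
  with canonicalRuns-head j ((j ∸ p) / 2) js | sameParity-gap p≤j
... | r , rs , eq , len≤sum | inj₁ (same , even) rewrite eq | same | even =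
  trans (weight-join h B (blocks rs) (+-mono-≤ (m≤n+m 1 _) len≤sum))
        (cong (_+ weight (B ∷ blocks rs)) (sym (+-identityʳ (2 * h))))
  where B = (j ∸ p) / 2 + 1 ∷ map proj₂ r
... | r , rs , eq , len≤sum | inj₂ (different , odd) rewrite eq | different | odd =
  weight-split h (blocks (((j , (j ∸ p) / 2 + 1) ∷ r) ∷ rs))

lastOf : ℕ → List ℕ → ℕ
lastOf p [] = p
lastOf p (j ∷ js) = lastOf j js

weight-canonicalRuns : ∀ p h {is} → TwoPartition↑ p is →
  weight (blocks (canonicalRuns p h is)) + p ≡ 2 * h + 1 + lastOf p is
weight-canonicalRuns p h nil = cong (_+ p) (trans (weight-split h []) (+-identityʳ _))
weight-canonicalRuns p h {j ∷ js} (cons p≤j pjs) =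
  trans (cong (_+ p) (weight-canonicalRuns-step p h j js p≤j))
        (telescope h (g % 2) (g / 2) (weight (blocks next)) p (lastOf j js)
          (subst (λ x → weight (blocks next) + x ≡ 2 * (g / 2) + 1 + lastOf j js) j≡ ih))
  where
  g = j ∸ p
  next = canonicalRuns j (g / 2) js
  ih : weight (blocks next) + j ≡ 2 * (g / 2) + 1 + lastOf j js
  ih = weight-canonicalRuns j (g / 2) (TwoPartition↑-weaken (m≤m+n j 2) pjs)
  j≡ : j ≡ p + (g % 2 + g / 2 * 2)
  j≡ = trans (sym (m+[n∸m]≡n p≤j)) (cong (p +_) (m≡m%n+[m/n]*n g 2))
  telescope : ∀ h r q W p L → W + (p + (r + q * 2)) ≡ 2 * q + 1 + L → 2 * h + r + W + p ≡ 2 * h + 1 + L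
  telescope h r q W p L eq = +-cancelʳ-≡ (q * 2) _ _ (begin
    2 * h + r + W + p + q * 2        ≡⟨ lhs h r q W p ⟩
    2 * h + (W + (p + (r + q * 2)))  ≡⟨ cong (2 * h +_) eq ⟩
    2 * h + (2 * q + 1 + L)          ≡⟨ rhs h q L ⟩
    2 * h + 1 + L + q * 2            ∎)
    where
    open ≡-Reasoning
    lhs : ∀ h r q W p → 2 * h + r + W + p + q * 2 ≡ 2 * h + (W + (p + (r + q * 2)))
    lhs = solve-∀
    rhs : ∀ h q L → 2 * h + (2 * q + 1 + L) ≡ 2 * h + 1 + L + q * 2
    rhs = solve-∀

weight-𝒱 : ∀ c {is} → TwoPartition↑ 1 (suc (c * 2) ∷ is) →
           weight (𝒱 (suc (c * 2) ∷ is)) ≡ lastOf (suc (c * 2)) is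
weight-𝒱 c {is} (cons _ pis) = +-cancelʳ-≡ (suc (c * 2)) _ _ (begin
  weight (𝒱 (suc (c * 2) ∷ is)) + suc (c * 2)  ≡⟨ weight-canonicalRuns (suc (c * 2)) ((c * 2) / 2) pis′ ⟩
  2 * ((c * 2) / 2) + 1 + L                    ≡⟨ cong (λ x → 2 * x + 1 + L) (m*n/n≡m c 2) ⟩
  2 * c + 1 + L                                ≡⟨ reorder c L ⟩
  L + suc (c * 2)                              ∎)
  where
  open ≡-Reasoning
  L = lastOf (suc (c * 2)) is
  pis′ : TwoPartition↑ (suc (c * 2)) is
  pis′ = TwoPartition↑-weaken (m≤m+n (suc (c * 2)) 2) pis
  reorder : ∀ c L → 2 * c + 1 + L ≡ L + suc (c * 2)
  reorder = solve-∀

-- Ladders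

ladder : ℕ → ℕ → List ℕ
ladder a zero = []
ladder a (suc k) = a ∷ ladder (suc (suc a)) k

ladder-TwoPartition : ∀ {lo} a k → lo ≤ a → TwoPartition↑ lo (ladder a k)
ladder-TwoPartition a zero _ = nil
ladder-TwoPartition a (suc k) lo≤a =
  cons lo≤a (ladder-TwoPartition (suc (suc a)) k (≤-reflexive (+-comm a 2)))

fibSum-ladder : ∀ a k → fib a + fibSum (ladder (suc a) k) ≡ fib (a + k * 2)
fibSum-ladder a zero = trans (+-identityʳ (fib a)) (cong fib (sym (+-identityʳ a)))
fibSum-ladder a (suc k) = begin
  fib a + (fib (suc a) + rest)  ≡⟨ +-assoc (fib a) _ _ ⟨
  fib a + fib (suc a) + rest    ≡⟨ cong (_+ rest) (+-comm (fib a) (fib (suc a))) ⟩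
  fib (suc (suc a)) + rest      ≡⟨ fibSum-ladder (suc (suc a)) k ⟩
  fib (suc (suc a) + k * 2)     ≡⟨ cong fib a+[2+k*2]≡2+a+k*2 ⟨
  fib (a + suc k * 2)           ∎
  where
  open ≡-Reasoning
  rest = fibSum (ladder (suc (suc (suc a))) k)
  a+[2+k*2]≡2+a+k*2 : a + suc (suc (k * 2)) ≡ suc (suc (a + k * 2))
  a+[2+k*2]≡2+a+k*2 = trans (+-suc a (suc (k * 2))) (cong suc (+-suc a (k * 2)))

length-ladder : ∀ a k → length (ladder a k) ≡ k
length-ladder a zero = refl
length-ladder a (suc k) = cong suc (length-ladder (suc (suc a)) k)

assocVecFrom-ladder : ∀ a k → assocVecFrom a (ladder (suc (suc a)) k) ≡ replicate k 2
assocVecFrom-ladder a zero = refl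
assocVecFrom-ladder a (suc k) =
  cong₂ _∷_ (cong (λ x → x / 2 + 1) (m+n∸n≡m 2 a)) (assocVecFrom-ladder (suc (suc a)) k)

length-ladder≡ : ∀ a k {x} → length (ladder a (suc k)) ≡ length (x ∷ replicate k 2)
length-ladder≡ a k = cong suc (trans (length-ladder (suc (suc a)) k) (sym (length-replicate k)))

runs-ladder : ∀ a k x →
  runs (zipL (ladder a (suc k)) (x ∷ replicate k 2)) ≡ [ zipL (ladder a (suc k)) (x ∷ replicate k 2) ]
runs-ladder a zero x = refl
runs-ladder a (suc k) x rewrite runs-ladder (suc (suc a)) k 2 | sameParity-refl a = refl

𝒱-ladder : ∀ a k → 𝒱 (ladder a (suc k)) ≡ [ (a ∸ 1) / 2 + 1 ∷ replicate k 2 ]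
𝒱-ladder a k = begin
  blocks (runs (zipL I ((a ∸ 1) / 2 + 1 ∷ assocVecFrom a (ladder (suc (suc a)) k))))
    ≡⟨ cong (λ v → blocks (runs (zipL I ((a ∸ 1) / 2 + 1 ∷ v)))) (assocVecFrom-ladder a k) ⟩
  blocks (runs (zipL I v))  ≡⟨ cong blocks (runs-ladder a k ((a ∸ 1) / 2 + 1)) ⟩
  [ map proj₂ (zipL I v) ]  ≡⟨ cong [_] (map-proj₂-zipL I v (length-ladder≡ a k {(a ∸ 1) / 2 + 1})) ⟩
  [ v ]                     ∎
  where
  open ≡-Reasoning
  I = ladder a (suc k)
  v = (a ∸ 1) / 2 + 1 ∷ replicate k 2

𝒱-1∷ladder : ∀ m → 𝒱 (1 ∷ ladder 4 (suc m)) ≡ [ 1 ] ∷ [ replicate (suc m) 2 ]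
𝒱-1∷ladder m rewrite assocVecFrom-ladder 4 m | runs-ladder 4 m 2 =
  cong (λ v → [ 1 ] ∷ [ v ])
       (map-proj₂-zipL (ladder 4 (suc m)) (replicate (suc m) 2) (length-ladder≡ 4 m {2}))

-- Continuants and the words π

D-replicate-from : ∀ k m →
  foldl Dstep (ℤ.+ k , ℤ.+ suc k) (replicate m 2) ≡ (ℤ.+ (m + k) , ℤ.+ suc (m + k))
D-replicate-from k zero = refl
D-replicate-from k (suc m) = begin
  foldl Dstep (ℤ.+ suc k , ℤ.+ 2 ℤ.* ℤ.+ suc k ℤ.- ℤ.+ k) (replicate m 2)
    ≡⟨ cong (λ x → foldl Dstep (ℤ.+ suc k , x) (replicate m 2)) 2[1+k]-k ⟩
  foldl Dstep (ℤ.+ suc k , ℤ.+ suc (suc k)) (replicate m 2)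
    ≡⟨ D-replicate-from (suc k) m ⟩
  (ℤ.+ (m + suc k) , ℤ.+ suc (m + suc k))
    ≡⟨ cong (λ x → (ℤ.+ x , ℤ.+ suc x)) (+-suc m k) ⟩
  (ℤ.+ suc (m + k) , ℤ.+ suc (suc (m + k)))  ∎
  where
  open ≡-Reasoning
  2*[1+k]≡2+k+k : ∀ k → 2 * suc k ≡ 2 + k + k
  2*[1+k]≡2+k+k = solve-∀
  k≤2*[1+k] : k ≤ 2 * suc k
  k≤2*[1+k] = ≤-trans (m≤n+m k (2 + k)) (≤-reflexive (sym (2*[1+k]≡2+k+k k)))
  2[1+k]-k : ℤ.+ 2 ℤ.* ℤ.+ suc k ℤ.- ℤ.+ k ≡ ℤ.+ suc (suc k)
  2[1+k]-k = begin
    ℤ.+ 2 ℤ.* ℤ.+ suc k ℤ.- ℤ.+ k  ≡⟨ ℤ.m-n≡m⊖n (2 * suc k) k ⟩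
    (2 * suc k) ℤ.⊖ k              ≡⟨ ℤ.⊖-≥ k≤2*[1+k] ⟩
    ℤ.+ (2 * suc k ∸ k)            ≡⟨ cong (λ x → ℤ.+ (x ∸ k)) (2*[1+k]≡2+k+k k) ⟩
    ℤ.+ (2 + k + k ∸ k)            ≡⟨ cong ℤ.+_ (m+n∸n≡m (2 + k) k) ⟩
    ℤ.+ suc (suc k)                ∎

D-replicate : ∀ m → D (replicate m 2) ≡ ℤ.+ suc m
D-replicate m = trans (cong proj₂ (D-replicate-from 0 m)) (cong (ℤ.+_ ∘ suc) (+-identityʳ m))

D-1∷replicate : ∀ m → D (1 ∷ replicate m 2) ≡ ℤ.+ 1
D-1∷replicate m = cong proj₂ (unit m)
  where
  unit : ∀ m → foldl Dstep (ℤ.+ 1 , ℤ.+ 1) (replicate m 2) ≡ (ℤ.+ 1 , ℤ.+ 1)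
  unit zero = refl
  unit (suc m) = unit m

classWord-zero : ∀ p → classQZ p ≡ 0ℚ → classWord p ≡ []
classWord-zero p class≡0 with classQZ p ℚ.≟ 0ℚ
... | yes _ = refl
... | no class≢0 = ⊥-elim (class≢0 class≡0)

classWord-fixed : ∀ p → classQZ p ≡ p → p ≢ 0ℚ → classWord p ≡ [ p ]
classWord-fixed p class≡p p≢0 with classQZ p ℚ.≟ 0ℚ
... | yes class≡0 = ⊥-elim (p≢0 (trans (sym class≡p) class≡0))
... | no _ = cong [_] class≡p

classWord-integer : ∀ j → classWord (ℤ.+ j ℚ./ 1) ≡ []
classWord-integer j = subst (λ q → classWord q ≡ []) (sym j/1≡q) (classWord-zero q class≡0)
  where
  j⊥1 : Coprime j 1
  j⊥1 = Coprime.sym (1-coprimeTo j)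
  q = mkℚ (ℤ.+ j) 0 j⊥1
  j/1≡q : ℤ.+ j ℚ./ 1 ≡ q
  j/1≡q = ℚ.normalize-coprime j⊥1
  ⌊q⌋≡j : ℚ.floor q ≡ ℤ.+ j
  ⌊q⌋≡j = trans (div-pos-is-/ℕ (ℤ.+ j) 1) (cong ℤ.+_ (n/1≡n j))
  class≡0 : classQZ q ≡ 0ℚ
  class≡0 = begin
    q ℚ.- (ℚ.floor q ℚ./ 1)  ≡⟨ cong (λ z → q ℚ.- (z ℚ./ 1)) ⌊q⌋≡j ⟩
    q ℚ.- (ℤ.+ j ℚ./ 1)      ≡⟨ cong (λ z → q ℚ.- z) j/1≡q ⟩
    q ℚ.- q                  ≡⟨ ℚ.+-inverseʳ q ⟩
    0ℚ                       ∎
    where open ≡-Reasoning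

classWord-proper : ∀ m → classWord (ℤ.+ suc m ℚ./ suc (suc m)) ≡ [ ℤ.+ suc m ℚ./ suc (suc m) ]
classWord-proper m = subst (λ q → classWord q ≡ [ q ]) (sym m/n≡q) (classWord-fixed q class≡q q≢0)
  where
  m⊥n : Coprime (suc m) (suc (suc m))
  m⊥n = subst (Coprime (suc m)) (+-comm (suc m) 1) (Coprime.sym (coprime-+ (1-coprimeTo (suc m))))
  q = mkℚ (ℤ.+ suc m) (suc m) m⊥n
  m/n≡q : ℤ.+ suc m ℚ./ suc (suc m) ≡ q
  m/n≡q = ℚ.normalize-coprime m⊥n
  ⌊q⌋≡0 : ℚ.floor q ≡ ℤ.+ 0
  ⌊q⌋≡0 = trans (div-pos-is-/ℕ (ℤ.+ suc m) (suc (suc m)))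
                (cong ℤ.+_ (m<n⇒m/n≡0 (n<1+n (suc m))))
  class≡q : classQZ q ≡ q
  class≡q = trans (cong (λ z → q ℚ.- (z ℚ./ 1)) ⌊q⌋≡0) (ℚ.+-identityʳ q)
  q≢0 : q ≢ 0ℚ
  q≢0 q≡0 with cong ℚ.numerator q≡0
  ... | ()

πBlocks-ladder-1 : ∀ m → πBlocks (𝒱 (ladder 1 (suc m))) ≡ []
πBlocks-ladder-1 m rewrite 𝒱-ladder 1 m | D-replicate m | D-1∷replicate m =
  cong (_++ []) (classWord-integer (suc m))

πBlocks-ladder-3 : ∀ m → πBlocks (𝒱 (ladder 3 (suc m))) ≡ πBlocks (𝒱 (1 ∷ ladder 4 (suc m)))
πBlocks-ladder-3 m rewrite 𝒱-ladder 3 m | 𝒱-1∷ladder m | D-replicate m | D-replicate (suc m) =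
  trans (cong (_++ []) (classWord-proper m))
        (cong (_++ [ ℤ.+ suc m ℚ./ suc (suc m) ]) (sym (classWord-integer 1)))

-- Essential numbers

even⊎odd : ∀ n → (∃[ c ] n ≡ c * 2) ⊎ (∃[ c ] n ≡ suc (c * 2))
even⊎odd zero = inj₁ (0 , refl)
even⊎odd (suc n) with even⊎odd n
... | inj₁ (c , refl) = inj₂ (c , refl)
... | inj₂ (c , refl) = inj₁ (suc c , refl)

c*2≢1 : ∀ c → c * 2 ≢ 1
c*2≢1 (suc c) ()

TwoPartition↑-pred : ∀ {lo I} → TwoPartition↑ (suc lo) I →
                     ∃[ I′ ] I ≡ map suc I′ × TwoPartition↑ lo I′
TwoPartition↑-pred nil = [] , refl , nil
TwoPartition↑-pred {I = suc i ∷ _} (cons (s≤s lo≤i) pI) =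
  let I′ , I≡ , pI′ = TwoPartition↑-pred pI
  in i ∷ I′ , cong (suc i ∷_) I≡ , cons lo≤i pI′

fibSum-≤-map-suc : ∀ I → fibSum I ≤ fibSum (map suc I)
fibSum-≤-map-suc [] = z≤n
fibSum-≤-map-suc (i ∷ I) = +-mono-≤ (fib-≤-suc i) (fibSum-≤-map-suc I)

essential⇒¬evenHead : ∀ {n c is} → Essential n → Z n ≢ suc (suc (c * 2)) ∷ is
essential⇒¬evenHead {n} {c} {is} essential Z≡ = essential (fibSum lowered) fibSum<n π≡
  where
  pZ : TwoPartition↑ 1 (suc (suc (c * 2)) ∷ is)
  pZ = subst (TwoPartition↑ 1) Z≡ (proj₁ (Z-spec n))
  tail-pred : ∃[ I′ ] is ≡ map suc I′ × TwoPartition↑ (suc (c * 2) + 2) I′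
  tail-pred with pZ
  ... | cons _ pis = TwoPartition↑-pred pis
  I′ = proj₁ tail-pred
  lowered = suc (c * 2) ∷ I′
  map-suc-lowered≡Z : map suc lowered ≡ Z n
  map-suc-lowered≡Z = sym (trans Z≡ (cong (suc (suc (c * 2)) ∷_) (proj₁ (proj₂ tail-pred))))
  fibSum<n : fibSum lowered < n
  fibSum<n = begin-strict
    fib (suc (c * 2)) + fibSum I′
      <⟨ +-mono-<-≤ (m<m+n _ (1≤fib (c * 2))) (fibSum-≤-map-suc I′) ⟩
    fib (suc (suc (c * 2))) + fibSum (map suc I′)  ≡⟨ cong fibSum map-suc-lowered≡Z ⟩
    fibSum (Z n)                                   ≡⟨ proj₂ (Z-spec n) ⟩
    n                                              ∎
    where open ≤-Reasoning
  π≡ : π (fibSum lowered) ≡ π n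
  π≡ = cong πBlocks (begin
    𝒱 (Z (fibSum lowered))  ≡⟨ cong 𝒱 (Z-fibSum (cons (s≤s z≤n) (proj₂ (proj₂ tail-pred)))) ⟩
    𝒱 lowered               ≡⟨ 𝒱-shift c I′ ⟨
    𝒱 (map suc lowered)     ≡⟨ cong 𝒱 map-suc-lowered≡Z ⟩
    𝒱 (Z n)                 ∎)
    where open ≡-Reasoning

essential⇒oddHead : ∀ {n} → 1 ≤ n → Essential n → ∃[ c ] ∃[ is ] (Z n ≡ suc (c * 2) ∷ is)
essential⇒oddHead {n} 1≤n essential = shape (Z n) refl
  where
  shape : ∀ I → Z n ≡ I → ∃[ c ] ∃[ is ] (Z n ≡ suc (c * 2) ∷ is)
  shape [] Z≡[] = ⊥-elim (<⇒≢ 1≤n (trans (sym (cong fibSum Z≡[])) (proj₂ (Z-spec n))))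
  shape (i ∷ is) Z≡ with even⊎odd i | subst (TwoPartition↑ 1) Z≡ (proj₁ (Z-spec n))
  ... | inj₂ (c , refl) | _ = c , is , Z≡
  ... | inj₁ (zero , refl) | cons () _
  ... | inj₁ (suc c , refl) | _ = ⊥-elim (essential⇒¬evenHead {c = c} essential Z≡)

fibSum-bound : ∀ {lo i is} → TwoPartition↑ lo (i ∷ is) → 1 ≤ i →
               fib (i ∸ 1) + fibSum (i ∷ is) ≤ fib (suc (lastOf i is))
fibSum-bound {i = suc i} {[]} _ _ =
  ≤-reflexive (trans (cong (fib i +_) (+-identityʳ _)) (+-comm (fib i) (fib (suc i))))
fibSum-bound {i = suc i} {j ∷ js} (cons _ (cons i+3≤j pjs)) _ = begin
  fib i + (fib (suc i) + rest)  ≡⟨ +-assoc (fib i) _ _ ⟨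
  fib i + fib (suc i) + rest    ≡⟨ cong (_+ rest) (+-comm (fib i) _) ⟩
  fib (suc (suc i)) + rest      ≤⟨ +-monoˡ-≤ rest (fib-mono-≤ i+2≤j∸1) ⟩
  fib (j ∸ 1) + rest            ≤⟨ fibSum-bound (cons ≤-refl pjs) (≤-trans (s≤s z≤n) i+3≤j) ⟩
  fib (suc (lastOf j js))       ∎
  where
  open ≤-Reasoning
  rest = fibSum (j ∷ js)
  i+2≤j∸1 : suc (suc i) ≤ j ∸ 1
  i+2≤j∸1 = subst (_≤ j ∸ 1) (m+n∸n≡m (suc (suc i)) 1)
                  (∸-monoˡ-≤ 1 (subst (_≤ j) (cong suc (+-suc i 1)) i+3≤j))

fibSum<fib[1+last] : ∀ {i is} → TwoPartition↑ 1 (i ∷ is) → fibSum (i ∷ is) < fib (suc (lastOf i is))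
fibSum<fib[1+last] {i} p@(cons 1≤i _) = ≤-trans (+-monoˡ-≤ _ (1≤fib (i ∸ 1))) (fibSum-bound p 1≤i)

lastOf-lower : ∀ {lo i is} → TwoPartition↑ lo (i ∷ is) → i + length is * 2 ≤ lastOf i is
lastOf-lower {i = i} {[]} _ = ≤-reflexive (+-identityʳ i)
lastOf-lower {i = i} {j ∷ js} (cons _ (cons i+2≤j pjs)) = begin
  i + suc (length js) * 2  ≡⟨ regroup i (length js) ⟩
  i + 2 + length js * 2    ≤⟨ +-monoˡ-≤ _ i+2≤j ⟩
  j + length js * 2        ≤⟨ lastOf-lower (cons ≤-refl pjs) ⟩
  lastOf j js              ∎
  where
  open ≤-Reasoning
  regroup : ∀ i k → i + suc k * 2 ≡ i + 2 + k * 2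
  regroup = solve-∀

ladder-unique : ∀ a i is → TwoPartition↑ a (i ∷ is) → lastOf i is ≤ a + length is * 2 →
                i ∷ is ≡ ladder a (suc (length is))
ladder-unique a i [] (cons a≤i _) i≤a+0 = cong [_] (≤-antisym (subst (i ≤_) (+-identityʳ a) i≤a+0) a≤i)
ladder-unique a i (j ∷ js) p@(cons a≤i pjjs) last≤ =
  cong₂ _∷_ i≡a
    (ladder-unique (suc (suc a)) j js pjjs′ (subst (lastOf j js ≤_) (regroup a (length js)) last≤))
  where
  i≡a : i ≡ a
  i≡a = ≤-antisym (+-cancelʳ-≤ _ i a (≤-trans (lastOf-lower p) last≤)) a≤i
  pjjs′ : TwoPartition↑ (suc (suc a)) (j ∷ js)
  pjjs′ = subst (λ lo → TwoPartition↑ lo (j ∷ js)) (trans (cong (_+ 2) i≡a) (+-comm a 2)) pjjs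
  regroup : ∀ a k → a + suc k * 2 ≡ suc (suc a) + k * 2
  regroup = solve-∀

fibSum-ladder-≤ : ∀ a k → fibSum (ladder a k) ≤ fibSum (ladder (suc a) k)
fibSum-ladder-≤ a zero = z≤n
fibSum-ladder-≤ a (suc k) = +-mono-≤ (fib-≤-suc a) (fibSum-ladder-≤ (suc (suc a)) k)

sum-allTwos : ∀ {B} → All (_≡ 2) B → sum B ≡ length B + length B
sum-allTwos [] = refl
sum-allTwos {_ ∷ B} (refl ∷ twos) =
  cong suc (trans (cong suc (sum-allTwos twos)) (sym (+-suc (length B) (length B))))

d-allTwos : ∀ {B} → All (_≡ 2) B → d B ≡ length B
d-allTwos {B} twos = trans (cong (_∸ length B) (sum-allTwos twos)) (m+n∸n≡m (length B) (length B))

-- The parts 3, 5, …, 2k + 1 are forced: the head by its coordinate 2, the end by weight-𝒱.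
singleTwos⇒ladder : ∀ c is {B} → TwoPartition↑ 1 (suc (c * 2) ∷ is) →
                    𝒱 (suc (c * 2) ∷ is) ≡ [ B ] → All (_≡ 2) B →
                    suc (c * 2) ∷ is ≡ ladder 3 (length B)
singleTwos⇒ladder c is {B} p@(cons _ pis) 𝒱≡ twos =
  subst (λ k → I ≡ ladder 3 k) (sym length-B) (ladder-unique 3 (suc (c * 2)) is p₃ last≤)
  where
  I = suc (c * 2) ∷ is
  B≡ : B ≡ assocVec I
  B≡ = trans (sym (++-identityʳ B)) (trans (cong concat (sym 𝒱≡)) (concat-𝒱 I))
  length-B : length B ≡ suc (length is)
  length-B = trans (cong length B≡) (length-assocVec I)
  c≡1 : c ≡ 1
  c≡1 with subst (All (_≡ 2)) B≡ twos
  ... | head≡2 ∷ _ = trans (sym (m*n/n≡m c 2)) (+-cancelʳ-≡ 1 _ _ head≡2)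
  p₃ : TwoPartition↑ 3 I
  p₃ = cons (≤-reflexive (cong (λ x → suc (x * 2)) (sym c≡1))) pis
  last≡ : lastOf (suc (c * 2)) is ≡ 3 + length is * 2
  last≡ = begin
    lastOf (suc (c * 2)) is  ≡⟨ weight-𝒱 c p ⟨
    weight (𝒱 I)             ≡⟨ cong weight 𝒱≡ ⟩
    2 * (d B + 0) + 1        ≡⟨ cong (λ x → 2 * (x + 0) + 1) (trans (d-allTwos twos) length-B) ⟩
    2 * (suc k + 0) + 1      ≡⟨ regroup k ⟩
    3 + k * 2                ∎
    where
    open ≡-Reasoning
    k = length is
    regroup : ∀ k → 2 * (suc k + 0) + 1 ≡ 3 + k * 2
    regroup = solve-∀
  last≤ : lastOf (suc (c * 2)) is ≤ 3 + length is * 2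
  last≤ = ≤-reflexive last≡

<∧≢∸1⇒≤∸2 : ∀ {m n} → m < n → m ≢ n ∸ 1 → m ≤ n ∸ 2
<∧≢∸1⇒≤∸2 {n = suc n} (s≤s m≤n) m≢n with ≤∧≢⇒< m≤n m≢n
... | s≤s m≤n∸1 = m≤n∸1

replicate-twos : ∀ k → All (_≡ 2) (replicate k 2)
replicate-twos zero = []
replicate-twos (suc k) = refl ∷ replicate-twos k

module EssentialBound {n : ℕ} (1≤n : 1 ≤ n) (essential : Essential n)
                      {c : ℕ} {is : List ℕ} (Z≡ : Z n ≡ suc (c * 2) ∷ is) where

  I : List ℕ
  I = suc (c * 2) ∷ is

  L : ℕ
  L = lastOf (suc (c * 2)) is

  F : ℕ
  F = fib (suc L)

  pI : TwoPartition↑ 1 I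
  pI = subst (TwoPartition↑ 1) Z≡ (proj₁ (Z-spec n))

  fibSum-I : fibSum I ≡ n
  fibSum-I = trans (cong fibSum (sym Z≡)) (proj₂ (Z-spec n))

  I≡by-value : ∀ k {X} → TwoPartition↑ 1 X → k + fibSum X ≡ F → n ≡ F ∸ k → I ≡ X
  I≡by-value k {X} pX sum≡ n≡ = trans (sym Z≡) (Z-unique pX (begin
    fibSum X            ≡⟨ m+n∸m≡n k (fibSum X) ⟨
    k + fibSum X ∸ k    ≡⟨ cong (_∸ k) sum≡ ⟩
    F ∸ k               ≡⟨ n≡ ⟨
    n                   ∎))
    where open ≡-Reasoning

  π≡ : ∀ {X} → I ≡ X → π n ≡ πBlocks (𝒱 X)
  π≡ I≡X = cong (πBlocks ∘ 𝒱) (trans Z≡ I≡X)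

  1≤L : 1 ≤ L
  1≤L = ≤-trans (s≤s z≤n) (lastOf-lower pI)

  n<F : n < F
  n<F = subst (_< F) fibSum-I (fibSum<fib[1+last] pI)

  n≢F∸1 : n ≢ F ∸ 1
  n≢F∸1 n≡ with even⊎odd L
  ... | inj₁ (zero , L≡0) = ⊥-elim (<⇒≢ 1≤L (sym L≡0))
  ... | inj₁ (suc m , L≡) = c*2≢1 c (suc-injective (∷-injectiveˡ I≡ladder))
    where
    I≡ladder : I ≡ ladder 2 (suc m)
    I≡ladder = I≡by-value 1 (ladder-TwoPartition 2 (suc m) (s≤s z≤n))
                 (trans (fibSum-ladder 1 (suc m)) (cong (fib ∘ suc) (sym L≡))) n≡
  ... | inj₂ (m , L≡) = essential 0 1≤n (sym (trans (π≡ I≡ladder) (πBlocks-ladder-1 m)))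
    where
    I≡ladder : I ≡ ladder 1 (suc m)
    I≡ladder = I≡by-value 1 (ladder-TwoPartition 1 (suc m) ≤-refl)
                 (trans (fibSum-ladder 0 (suc m)) (cong (fib ∘ suc) (sym L≡))) n≡

  n≤F∸2 : n ≤ F ∸ 2
  n≤F∸2 = <∧≢∸1⇒≤∸2 n<F n≢F∸1

  I≡1∷ladder : ∀ m → L ≡ suc m * 2 → n ≡ F ∸ 2 → I ≡ 1 ∷ ladder 4 m
  I≡1∷ladder m L≡ = I≡by-value 2 (cons ≤-refl (ladder-TwoPartition 4 m (s≤s (s≤s (s≤s z≤n)))))
                      (trans (fibSum-ladder 3 m) (cong (fib ∘ suc) (sym L≡)))

  I≡ladder3 : ∀ m → L ≡ suc (m * 2) → n ≡ F ∸ 2 → I ≡ ladder 3 m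
  I≡ladder3 m L≡ = I≡by-value 2 (ladder-TwoPartition 3 m (s≤s z≤n))
                     (trans (fibSum-ladder 2 m) (cong (fib ∘ suc) (sym L≡)))

  F∸2⇒singleTwos : n ≡ F ∸ 2 → ∃[ B ] 𝒱 (Z n) ≡ [ B ] × All (_≡ 2) B
  F∸2⇒singleTwos n≡ with even⊎odd L
  ... | inj₁ (zero , L≡0) = ⊥-elim (<⇒≢ 1≤L (sym L≡0))
  ... | inj₁ (suc zero , L≡2) = ⊥-elim (<⇒≢ (s≤s (s≤s z≤n)) (trans (sym L≡1) L≡2))
    where
    I≡[1] : I ≡ 1 ∷ []
    I≡[1] = I≡1∷ladder 0 L≡2 n≡
    L≡1 : L ≡ 1
    L≡1 = cong₂ lastOf (∷-injectiveˡ I≡[1]) (∷-injectiveʳ I≡[1])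
  ... | inj₁ (suc (suc m) , L≡) = ⊥-elim (essential (fibSum K) K<n πK≡πn)
    where
    I≡X : I ≡ 1 ∷ ladder 4 (suc m)
    I≡X = I≡1∷ladder (suc m) L≡ n≡
    K = ladder 3 (suc m)
    K<n : fibSum K < n
    K<n = subst (fibSum K <_) (trans (sym (cong fibSum I≡X)) fibSum-I)
                (s≤s (fibSum-ladder-≤ 3 (suc m)))
    πK≡πn : π (fibSum K) ≡ π n
    πK≡πn = trans (cong (πBlocks ∘ 𝒱) (Z-fibSum (ladder-TwoPartition 3 (suc m) (s≤s z≤n))))
                  (trans (πBlocks-ladder-3 m) (sym (π≡ I≡X)))
  ... | inj₂ (zero , L≡) with I≡ladder3 0 L≡ n≡
  ...   | ()
  F∸2⇒singleTwos n≡ | inj₂ (suc m , L≡) =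
    replicate (suc m) 2 ,
    trans (cong 𝒱 (trans Z≡ (I≡ladder3 (suc m) L≡ n≡))) (𝒱-ladder 3 m) ,
    replicate-twos (suc m)

  singleTwos⇒F∸2 : ∀ B → 𝒱 (Z n) ≡ [ B ] → All (_≡ 2) B →
                   (n ≡ F ∸ 2) × (n ≡ fib (2 * length B + 2) ∸ 2)
  singleTwos⇒F∸2 B 𝒱≡ twos = subst (λ x → n ≡ fib x ∸ 2) (sym 1+L≡) n≡ , n≡
    where
    k = length B
    𝒱I≡ : 𝒱 I ≡ [ B ]
    𝒱I≡ = trans (cong 𝒱 (sym Z≡)) 𝒱≡
    n≡ : n ≡ fib (2 * k + 2) ∸ 2
    n≡ = begin
      n                               ≡⟨ fibSum-I ⟨
      fibSum I                        ≡⟨ cong fibSum (singleTwos⇒ladder c is pI 𝒱I≡ twos) ⟩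
      fibSum (ladder 3 k)             ≡⟨ m+n∸m≡n 2 (fibSum (ladder 3 k)) ⟨
      2 + fibSum (ladder 3 k) ∸ 2     ≡⟨ cong (_∸ 2) (fibSum-ladder 2 k) ⟩
      fib (2 + k * 2) ∸ 2             ≡⟨ cong (λ x → fib x ∸ 2) (reorder k) ⟩
      fib (2 * k + 2) ∸ 2             ∎
      where
      open ≡-Reasoning
      reorder : ∀ k → 2 + k * 2 ≡ 2 * k + 2
      reorder = solve-∀
    1+L≡ : suc L ≡ 2 * k + 2
    1+L≡ = begin
      suc L                    ≡⟨ cong suc (weight-𝒱 c pI) ⟨
      suc (weight (𝒱 I))       ≡⟨ cong (suc ∘ weight) 𝒱I≡ ⟩
      suc (2 * (d B + 0) + 1)  ≡⟨ cong (λ x → suc (2 * (x + 0) + 1)) (d-allTwos twos) ⟩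
      suc (2 * (k + 0) + 1)    ≡⟨ reorder k ⟩
      2 * k + 2                ∎
      where
      open ≡-Reasoning
      reorder : ∀ k → suc (2 * (k + 0) + 1) ≡ 2 * k + 2
      reorder = solve-∀

TightBound : ℕ → ℕ → Set
TightBound n F = (n ≤ F ∸ 2)
  × (n ≡ F ∸ 2 → Σ (List ℕ) (λ B → (𝒱 (Z n) ≡ B ∷ []) × All (_≡ 2) B))
  × ((B : List ℕ) → 𝒱 (Z n) ≡ B ∷ [] → All (_≡ 2) B →
       (n ≡ F ∸ 2) × (n ≡ fib (2 * length B + 2) ∸ 2))

lemma4p2 : (n : ℕ) → 1 ≤ n → Essential n →
    (n ≤ fib (2 * sum (map d (𝒱 (Z n))) + length (𝒱 (Z n)) + 1) ∸ 2)
    × (n ≡ fib (2 * sum (map d (𝒱 (Z n))) + length (𝒱 (Z n)) + 1) ∸ 2 →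
         Σ (List ℕ) (λ B → (𝒱 (Z n) ≡ B ∷ []) × All (_≡ 2) B))
    × ((B : List ℕ) → 𝒱 (Z n) ≡ B ∷ [] → All (_≡ 2) B →
         (n ≡ fib (2 * sum (map d (𝒱 (Z n))) + length (𝒱 (Z n)) + 1) ∸ 2)
         × (n ≡ fib (2 * length B + 2) ∸ 2))
lemma4p2 n 1≤n essential =
  let c , is , Z≡ = essential⇒oddHead 1≤n essential
      open EssentialBound 1≤n essential {c} Z≡
      weight+1≡ : weight (𝒱 (Z n)) + 1 ≡ suc L
      weight+1≡ = trans (cong (λ I → weight (𝒱 I) + 1) Z≡)
                        (trans (cong (_+ 1) (weight-𝒱 c pI)) (+-comm L 1))
  in subst (TightBound n ∘ fib) (sym weight+1≡) (n≤F∸2 , F∸2⇒singleTwos , singleTwos⇒F∸2)
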